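{- Let $L$ be a complete atomistic lattice. A binary operation $T_\diamond$ on $L$ is a left-semicontinuous t-norm on $L$ if and only if there exists a t-norm $T$ on $C(L)=A(L)\cup\{0,1\}$ such that $T_\diamond=\overline{T}$, where $\overline{T}(x,y)=\bigvee_{u\in\kappa(x)}\bigvee_{v\in\kappa(y)}T(u,v)$ with $\kappa(x)=\{u\in C(L)\setminus\{0\}\mid u\le x\}$, and $T$ satisfies: for every $S\subseteq L$ with $\bigvee S\ne 1$, $T(u,u)=0$ for every $u\in A(\bigvee S)\setminus\bigcup_{x\in S}A(x)$.
   Context: A lattice $L$ with bottom $0$ and top $1$ is atomistic if every element is a join of atoms (elements covering $0$); $A(L)$ is the set of atoms, $A(x)=\{a\in A(L)\mid a\le x\}$, and $C(L)=A(L)\cup\{0,1\}$ has the order inherited from $L$. A t-norm on a bounded poset with top $1$ is a binary operation that is monotone in each argument, commutative, associative, with neutral element $1$. A t-norm $T$ on a complete lattice $L$ is left-semicontinuous if $T(a,\bigvee S)=\bigvee_{x\in S}T(a,x)$ for every $a\in L$ and every $S\subseteq L$ with $\bigvee S\ne 1$. -}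

module Defs where

open import Level using (Level; suc; _⊔_)
open import Data.Product using (Σ; ∃; _×_; _,_)
open import Data.Sum using (_⊎_; inj₁; inj₂)
open import Data.Empty using (⊥)
open import Relation.Nullary using (¬_)
open import Relation.Unary using (Pred)
open import Relation.Binary.PropositionalEquality using (_≡_; _≢_; refl)
open import Data.Refinement using (Refinement; value)
import Data.Refinement as Ref
open import Data.Irrelevant using ([_])

record CompleteLattice (ℓ : Level) : Set (suc ℓ) where
  field
    Carrier   : Set ℓ
    _≤_       : Carrier → Carrier → Set ℓ
    ≤-refl    : ∀ {x} → x ≤ x
    ≤-trans   : ∀ {x y z} → x ≤ y → y ≤ z → x ≤ z
    ≤-antisym : ∀ {x y} → x ≤ y → y ≤ x → x ≡ y
    ⋁         : Pred Carrier ℓ → Carrier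
    ⋁-ub      : ∀ (S : Pred Carrier ℓ) {x} → S x → x ≤ ⋁ S
    ⋁-least   : ∀ (S : Pred Carrier ℓ) {z} → (∀ {x} → S x → x ≤ z) → ⋁ S ≤ z

  ⊥L : Carrier
  ⊥L = ⋁ (λ _ → Lift⊥)
    where
      Lift⊥ : Set ℓ
      Lift⊥ = Level.Lift ℓ ⊥

  ⊤L : Carrier
  ⊤L = ⋁ (λ _ → Level.Lift ℓ Data.Unit.⊤)
    where import Data.Unit

  IsAtom : Carrier → Set ℓ
  IsAtom a = (a ≢ ⊥L) × (∀ x → x ≤ a → (x ≡ ⊥L) ⊎ (x ≡ a))
  -- (⊥L ≤ a holds automatically)

  A : Carrier → Pred Carrier ℓ
  A x a = IsAtom a × (a ≤ x)

  IsAtomistic : Set (suc ℓ)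
  IsAtomistic = ∀ x → Σ (Pred Carrier ℓ) λ S → (∀ {a} → S a → IsAtom a) × (x ≡ ⋁ S)

  InC : Carrier → Set ℓ
  InC x = IsAtom x ⊎ (x ≡ ⊥L) ⊎ (x ≡ ⊤L)

  C : Set ℓ
  C = Refinement Carrier InC

  _≤C_ : C → C → Set ℓ
  u ≤C v = value u ≤ value v

  ⊤C : C
  ⊤C = Ref._,_ ⊤L [ inj₂ (inj₂ refl) ]

  atomC : (a : Carrier) → IsAtom a → C
  atomC a p = Ref._,_ a [ inj₁ p ]

record IsTNorm {ℓ : Level} (X : Set ℓ) (_≤_ : X → X → Set ℓ) (⊤ : X)
               (T : X → X → X) : Set ℓ where
  field
    monoˡ    : ∀ {x y} z → x ≤ y → T x z ≤ T y z
    monoʳ    : ∀ z {x y} → x ≤ y → T z x ≤ T z y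
    comm     : ∀ x y → T x y ≡ T y x
    assoc    : ∀ x y z → T (T x y) z ≡ T x (T y z)
    identityʳ : ∀ x → T x ⊤ ≡ x

module _ {ℓ : Level} (L : CompleteLattice ℓ) where
  open CompleteLattice L

  IsTNormL : (Carrier → Carrier → Carrier) → Set ℓ
  IsTNormL = IsTNorm Carrier _≤_ ⊤L

  IsLeftSemicontinuous : (Carrier → Carrier → Carrier) → Set (suc ℓ)
  IsLeftSemicontinuous T =
    ∀ (a : Carrier) (S : Pred Carrier ℓ) → ⋁ S ≢ ⊤L →
      T a (⋁ S) ≡ ⋁ (λ z → Σ Carrier λ x → S x × (z ≡ T a x))

  IsLeftSemicontinuousTNorm : (Carrier → Carrier → Carrier) → Set (suc ℓ)
  IsLeftSemicontinuousTNorm T = IsTNormL T × IsLeftSemicontinuous T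

  IsTNormC : (C → C → C) → Set ℓ
  IsTNormC = IsTNorm C _≤C_ ⊤C

  κ : Carrier → Pred C ℓ
  κ x u = (value u ≢ ⊥L) × (value u ≤ x)

  extend : (C → C → C) → Carrier → Carrier → Carrier
  extend T x y =
    ⋁ (λ z → Σ C λ u → κ x u ×
         (z ≡ ⋁ (λ w → Σ C λ v → κ y v × (w ≡ value (T u v)))))

  AtomCondition : (C → C → C) → Set (suc ℓ)
  AtomCondition T =
    ∀ (S : Pred Carrier ℓ) → ⋁ S ≢ ⊤L →
      ∀ (u : Carrier) (p : IsAtom u) → u ≤ ⋁ S →
        ¬ (Σ Carrier λ x → S x × A x u) →
        value (T (atomC u p) (atomC u p)) ≡ ⊥L

-- Since T(u, v) ≤ u ∧ v, the T-product of two distinct atoms is 0, and that of an atom with itself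
-- is 0 or the atom. Hence, away from the top element, T̄(x, y) is the join of the T-idempotent
-- atoms below both x and y; associativity of T̄ follows, and T̄(a, ⋁S) = ⋁ₓ T̄(a, x) can only fail
-- at an idempotent atom of A(⋁S) lying in no A(x), x ∈ S, which the atom condition excludes.
-- Conversely, a t-norm on L maps C(L) into itself, and writing each argument ≠ 1 as a join of
-- atoms, left-semicontinuity recovers it from its restriction to C(L).
--
-- Constructively, a ≤ e is decidable for an atom a, so in an atomistic lattice every inequality
-- is ¬¬-stable; this pays for all case distinctions (on elements of C(L), on x ≡ 1, ...).
{-# OPTIONS --safe #-}
module Submission where

open import Defs
open import Level using (Level; lift)
open import Data.Product using (Σ; _×_; _,_; proj₁; proj₂)
open import Data.Sum using (_⊎_; inj₁; inj₂)
open import Data.Unit using (tt)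
open import Data.Irrelevant using (Irrelevant; [_])
open import Data.Refinement using (value; proof; value-injective)
import Data.Refinement as Refinement
import Data.Irrelevant as Irrelevant
open import Function.Bundles using (_⇔_; mk⇔)
open import Relation.Nullary using (¬_; Dec; yes; no; Stable; contradiction)
open import Relation.Nullary.Decidable using (decidable-stable; ¬¬-excluded-middle)
open import Relation.Nullary.Negation using (¬¬-map)
open import Relation.Nullary.Recomputable using (¬-recompute)
open import Relation.Unary using (Pred)
open import Relation.Binary.PropositionalEquality
  using (_≡_; _≢_; refl; sym; trans; cong; cong₂; subst; subst₂; isEquivalence; module ≡-Reasoning)
open import Relation.Binary.Bundles using (Poset)
import Relation.Binary.Reasoning.PartialOrder as PartialOrderReasoning

irrelevant⇒¬¬ : ∀ {a} {P : Set a} → Irrelevant P → ¬ ¬ P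
irrelevant⇒¬¬ [ p ] = ¬-recompute (λ ¬p → ¬p p)

module TNormProperties {ℓ} {X : Set ℓ} {_≤_ : X → X → Set ℓ} {⊤ : X} {T : X → X → X}
                       (isTNorm : IsTNorm X _≤_ ⊤ T) (≤⊤ : ∀ {x} → x ≤ ⊤) where
  open IsTNorm isTNorm

  identityˡ : ∀ x → T ⊤ x ≡ x
  identityˡ x = trans (comm ⊤ x) (identityʳ x)

  Txy≤x : ∀ x y → T x y ≤ x
  Txy≤x x y = subst (T x y ≤_) (identityʳ x) (monoʳ x ≤⊤)

  Txy≤y : ∀ x y → T x y ≤ y
  Txy≤y x y = subst (_≤ y) (comm y x) (Txy≤x y x)

isTNorm-resp : ∀ {ℓ} {X : Set ℓ} {_≤_ : X → X → Set ℓ} {⊤ : X} {T T′ : X → X → X} →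
               (∀ x y → T x y ≡ T′ x y) → IsTNorm X _≤_ ⊤ T′ → IsTNorm X _≤_ ⊤ T
isTNorm-resp {_≤_ = _≤_} {T = T} {T′} T≗T′ isTNorm′ = record
  { monoˡ     = λ {x} {y} z p → subst₂ _≤_ (sym (T≗T′ x z)) (sym (T≗T′ y z)) (monoˡ z p)
  ; monoʳ     = λ z {x} {y} p → subst₂ _≤_ (sym (T≗T′ z x)) (sym (T≗T′ z y)) (monoʳ z p)
  ; comm      = λ x y → trans (T≗T′ x y) (trans (comm x y) (sym (T≗T′ y x)))
  ; assoc     = assoc-T
  ; identityʳ = λ x → trans (T≗T′ x _) (identityʳ x)
  }
  where
  open IsTNorm isTNorm′
  open ≡-Reasoning

  assoc-T : ∀ x y z → T (T x y) z ≡ T x (T y z)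
  assoc-T x y z = begin
    T (T x y) z     ≡⟨ T≗T′ _ z ⟩
    T′ (T x y) z    ≡⟨ cong (λ w → T′ w z) (T≗T′ x y) ⟩
    T′ (T′ x y) z   ≡⟨ assoc x y z ⟩
    T′ x (T′ y z)   ≡⟨ cong (T′ x) (T≗T′ y z) ⟨
    T′ x (T y z)    ≡⟨ T≗T′ x _ ⟨
    T x (T y z)     ∎

module _ {ℓ : Level} (L : CompleteLattice ℓ) where
  open CompleteLattice L

  ≤-reflexive : ∀ {x y} → x ≡ y → x ≤ y
  ≤-reflexive refl = ≤-refl

  ≤-poset : Poset ℓ ℓ ℓ
  ≤-poset = record
    { isPartialOrder = record
      { isPreorder = record { isEquivalence = isEquivalence ; reflexive = ≤-reflexive ; trans = ≤-trans }
      ; antisym    = ≤-antisym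
      }
    }

  module ≤-Reasoning = PartialOrderReasoning ≤-poset

  ⊥L-least : ∀ {x} → ⊥L ≤ x
  ⊥L-least = ⋁-least _ (λ { (lift ()) })

  ⊤L-greatest : ∀ {x} → x ≤ ⊤L
  ⊤L-greatest = ⋁-ub _ (lift tt)

  ⊤L≤⇒≡⊤L : ∀ {x} → ⊤L ≤ x → x ≡ ⊤L
  ⊤L≤⇒≡⊤L ⊤≤x = ≤-antisym ⊤L-greatest ⊤≤x

  ≤⊥L⇒≡⊥L : ∀ {x} → x ≤ ⊥L → x ≡ ⊥L
  ≤⊥L⇒≡⊥L x≤⊥ = ≤-antisym x≤⊥ ⊥L-least

  ⋁-mono : ∀ {P Q : Pred Carrier ℓ} → (∀ {x} → P x → Q x) → ⋁ P ≤ ⋁ Q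
  ⋁-mono P⊆Q = ⋁-least _ (λ px → ⋁-ub _ (P⊆Q px))

  ⋁-cong : ∀ {P Q : Pred Carrier ℓ} → (∀ {x} → P x → Q x) → (∀ {x} → Q x → P x) → ⋁ P ≡ ⋁ Q
  ⋁-cong P⊆Q Q⊆P = ≤-antisym (⋁-mono P⊆Q) (⋁-mono Q⊆P)

  atom⇒⊤L≢⊥L : ∀ {a} → IsAtom a → ⊤L ≢ ⊥L
  atom⇒⊤L≢⊥L {a} (a≢⊥ , _) ⊤≡⊥ = a≢⊥ (≤⊥L⇒≡⊥L (subst (a ≤_) ⊤≡⊥ ⊤L-greatest))

  -- The join of the common lower bounds of a and e is below the atom a, so it is ⊥ or a.
  atom-≤? : ∀ {a} → IsAtom a → ∀ e → Dec (a ≤ e)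
  atom-≤? {a} (a≢⊥ , below-a) e with below-a (⋁ M) (⋁-least M proj₁)
    where
    M : Pred Carrier ℓ
    M w = (w ≤ a) × (w ≤ e)
  ... | inj₂ ⋁M≡a = yes (subst (_≤ e) ⋁M≡a (⋁-least _ proj₂))
  ... | inj₁ ⋁M≡⊥ = no (λ a≤e → a≢⊥ (≤⊥L⇒≡⊥L (subst (a ≤_) ⋁M≡⊥ (⋁-ub _ (≤-refl , a≤e)))))

  κ-atom-or-⊤ : ∀ x u → κ L x u → ¬ ¬ (IsAtom (value u) ⊎ x ≡ ⊤L)
  κ-atom-or-⊤ x u (u≢⊥ , u≤x) = ¬¬-map classify (irrelevant⇒¬¬ (proof u))
    where
    classify : InC (value u) → IsAtom (value u) ⊎ x ≡ ⊤L
    classify (inj₁ u-atom)      = inj₁ u-atom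
    classify (inj₂ (inj₁ u≡⊥)) = contradiction u≡⊥ u≢⊥
    classify (inj₂ (inj₂ u≡⊤)) = inj₂ (⊤L≤⇒≡⊤L (subst (_≤ x) u≡⊤ u≤x))

  isLeftSemicontinuous-resp : ∀ {T T′ : Carrier → Carrier → Carrier} → (∀ x y → T x y ≡ T′ x y) →
                              IsLeftSemicontinuous L T′ → IsLeftSemicontinuous L T
  isLeftSemicontinuous-resp T≗T′ lsc′ a S ⋁S≢⊤ =
    trans (T≗T′ a (⋁ S)) (trans (lsc′ a S ⋁S≢⊤)
      (⋁-cong (λ { (x , sx , refl) → x , sx , sym (T≗T′ a x) })
              (λ { (x , sx , refl) → x , sx , T≗T′ a x })))

  module _ (T : C → C → C) where

    extend-ub : ∀ {x y u v} → κ L x u → κ L y v → value (T u v) ≤ extend L T x y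
    extend-ub ku kv = ≤-trans (⋁-ub _ (_ , kv , refl)) (⋁-ub _ (_ , ku , refl))

    extend-least : ∀ {x y z} → (∀ {u v} → κ L x u → κ L y v → value (T u v) ≤ z) →
                   extend L T x y ≤ z
    extend-least h = ⋁-least _ λ { (_ , ku , refl) → ⋁-least _ λ { (_ , kv , refl) → h ku kv } }

  module _ (atomistic : IsAtomistic) where

    ≤-from-atoms : ∀ {x y} → (∀ a → IsAtom a → a ≤ x → a ≤ y) → x ≤ y
    ≤-from-atoms {x} {y} h with atomistic x
    ... | S , S-atoms , x≡⋁S = subst (_≤ y) (sym x≡⋁S)
      (⋁-least S (λ {a} sa → h a (S-atoms sa) (subst (a ≤_) (sym x≡⋁S) (⋁-ub S sa))))

    ≤-stable : ∀ {x y} → Stable (x ≤ y)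
    ≤-stable {x} {y} ¬¬x≤y = ≤-from-atoms λ a a-atom a≤x →
      decidable-stable (atom-≤? a-atom y) (¬¬-map (≤-trans a≤x) ¬¬x≤y)

    ≤-from-¬¬ : ∀ {p} {P : Set p} {x y} → ¬ ¬ P → (P → x ≤ y) → x ≤ y
    ≤-from-¬¬ ¬¬p f = ≤-stable (¬¬-map f ¬¬p)

    module Extension {T : C → C → C} (isTNorm : IsTNormC L T) where
      open IsTNorm isTNorm
      open TNormProperties isTNorm ⊤L-greatest

      E : Carrier → Carrier → Carrier
      E = extend L T

      extend-≤ˡ : ∀ x y → E x y ≤ x
      extend-≤ˡ _ _ = extend-least T (λ {u} {v} ku _ → ≤-trans (Txy≤x u v) (proj₂ ku))

      extend-≤ʳ : ∀ x y → E x y ≤ y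
      extend-≤ʳ _ _ = extend-least T (λ {u} {v} _ kv → ≤-trans (Txy≤y u v) (proj₂ kv))

      extend-monoˡ : ∀ {x x′} y → x ≤ x′ → E x y ≤ E x′ y
      extend-monoˡ y x≤x′ = extend-least T (λ (u≢⊥ , u≤x) kv → extend-ub T (u≢⊥ , ≤-trans u≤x x≤x′) kv)

      extend-monoʳ : ∀ x {y y′} → y ≤ y′ → E x y ≤ E x y′
      extend-monoʳ x y≤y′ = extend-least T (λ ku (v≢⊥ , v≤y) → extend-ub T ku (v≢⊥ , ≤-trans v≤y y≤y′))

      extend-comm : ∀ x y → E x y ≡ E y x
      extend-comm x y = ≤-antisym (comm-≤ x y) (comm-≤ y x)
        where
        comm-≤ : ∀ x y → E x y ≤ E y x
        comm-≤ x y = extend-least T (λ {u} {v} ku kv →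
          subst (_≤ E y x) (cong value (comm v u)) (extend-ub T kv ku))

      extend-identityʳ : ∀ x → E x ⊤L ≡ x
      extend-identityʳ x = ≤-antisym (extend-≤ˡ x ⊤L) (≤-from-atoms λ a a-atom a≤x →
        subst (_≤ E x ⊤L) (cong value (identityʳ (atomC a a-atom)))
          (extend-ub T (proj₁ a-atom , a≤x) (atom⇒⊤L≢⊥L a-atom , ≤-refl)))

      extend-identityˡ : ∀ x → E ⊤L x ≡ x
      extend-identityˡ x = trans (extend-comm ⊤L x) (extend-identityʳ x)

      idempotent≤extend : ∀ {x y} (u : C) → value u ≢ ⊥L → value (T u u) ≡ value u →
                          value u ≤ x → value u ≤ y → value u ≤ E x y
      idempotent≤extend u u≢⊥ idem u≤x u≤y = subst (_≤ _) idem (extend-ub T (u≢⊥ , u≤x) (u≢⊥ , u≤y))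

      -- T u v lies below the atom u, and T u v = u forces u ≤ v, hence u = v.
      atom-product : ∀ {u v : C} → IsAtom (value u) → IsAtom (value v) →
                     value (T u v) ≡ ⊥L ⊎ (u ≡ v × value (T u u) ≡ value u)
      atom-product {u} {v} (u≢⊥ , below-u) (_ , below-v) with below-u _ (Txy≤x u v)
      ... | inj₁ Tuv≡⊥ = inj₁ Tuv≡⊥
      ... | inj₂ Tuv≡u with below-v _ (subst (_≤ value v) Tuv≡u (Txy≤y u v))
      ...   | inj₁ u≡⊥ = contradiction u≡⊥ u≢⊥
      ...   | inj₂ u≡v = inj₂ (value-injective u≡v ,
                               trans (cong (λ w → value (T u w)) (value-injective u≡v)) Tuv≡u)

      extend-assoc-≤ : ∀ x y z → E (E x y) z ≤ E x (E y z)
      extend-assoc-≤ x y z = extend-least T bound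
        where
        open ≤-Reasoning

        ⊤-case : E x y ≡ ⊤L → z ≤ E x (E y z)
        ⊤-case Exy≡⊤ = begin
          z             ≡⟨ extend-identityˡ z ⟨
          E ⊤L z        ≡⟨ extend-identityˡ _ ⟨
          E ⊤L (E ⊤L z) ≡⟨ cong₂ (λ x′ y′ → E x′ (E y′ z))
                                 (≥E⇒≡⊤ (extend-≤ˡ x y)) (≥E⇒≡⊤ (extend-≤ʳ x y)) ⟨
          E x (E y z)   ∎
          where
          ≥E⇒≡⊤ : ∀ {w} → E x y ≤ w → w ≡ ⊤L
          ≥E⇒≡⊤ Exy≤w = ⊤L≤⇒≡⊤L (subst (_≤ _) Exy≡⊤ Exy≤w)

        atom-case : ∀ {w t} → κ L (E x y) w → κ L z t →
                    value (T w t) ≡ ⊥L ⊎ (w ≡ t × value (T w w) ≡ value w) →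
                    value (T w t) ≤ E x (E y z)
        atom-case _ _ (inj₁ Twt≡⊥) = subst (_≤ E x (E y z)) (sym Twt≡⊥) ⊥L-least
        atom-case {w} (w≢⊥ , w≤Exy) (_ , w≤z) (inj₂ (refl , idem)) = subst (_≤ E x (E y z)) (sym idem)
          (idempotent≤extend w w≢⊥ idem (≤-trans w≤Exy (extend-≤ˡ x y))
            (idempotent≤extend w w≢⊥ idem (≤-trans w≤Exy (extend-≤ʳ x y)) w≤z))

        bound : ∀ {w t} → κ L (E x y) w → κ L z t → value (T w t) ≤ E x (E y z)
        bound {w} {t} kw kt = ≤-from-¬¬ (κ-atom-or-⊤ (E x y) w kw) λ
          { (inj₂ Exy≡⊤) → ≤-trans (Txy≤y w t) (≤-trans (proj₂ kt) (⊤-case Exy≡⊤))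
          ; (inj₁ w-atom) → ≤-from-¬¬ (κ-atom-or-⊤ z t kt) λ
            { (inj₂ z≡⊤) → begin
                value (T w t) ≤⟨ Txy≤x w t ⟩
                value w       ≤⟨ proj₂ kw ⟩
                E x y         ≡⟨ cong (E x) (extend-identityʳ y) ⟨
                E x (E y ⊤L)  ≡⟨ cong (λ z′ → E x (E y z′)) z≡⊤ ⟨
                E x (E y z)   ∎
            ; (inj₁ t-atom) → atom-case kw kt (atom-product w-atom t-atom)
            }
          }

      extend-assoc : ∀ x y z → E (E x y) z ≡ E x (E y z)
      extend-assoc x y z = ≤-antisym (extend-assoc-≤ x y z) (begin
        E x (E y z) ≡⟨ extend-comm x _ ⟩
        E (E y z) x ≤⟨ extend-assoc-≤ y z x ⟩
        E y (E z x) ≡⟨ extend-comm y _ ⟩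
        E (E z x) y ≤⟨ extend-assoc-≤ z x y ⟩
        E z (E x y) ≡⟨ extend-comm z _ ⟩
        E (E x y) z ∎)
        where open ≤-Reasoning

      extend-isTNorm : IsTNormL L E
      extend-isTNorm = record
        { monoˡ     = extend-monoˡ
        ; monoʳ     = extend-monoʳ
        ; comm      = extend-comm
        ; assoc     = extend-assoc
        ; identityʳ = extend-identityʳ
        }

      extend-isLeftSemicontinuous : AtomCondition L T → IsLeftSemicontinuous L E
      extend-isLeftSemicontinuous atomCondition a S ⋁S≢⊤ =
        ≤-antisym (extend-least T bound) (⋁-least R λ { (x , sx , refl) → extend-monoʳ a (⋁-ub S sx) })
        where
        open ≤-Reasoning

        R : Pred Carrier ℓ
        R z = Σ Carrier λ x → S x × z ≡ E a x

        S⊆R : a ≡ ⊤L → ∀ {x} → S x → R x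
        S⊆R a≡⊤ {x} sx = x , sx , sym (trans (cong (λ a′ → E a′ x) a≡⊤) (extend-identityˡ x))

        -- atomC (value u) u-atom is definitionally u, the membership proof of C being irrelevant.
        idempotent-atom-case : ∀ {u} → κ L a u → IsAtom (value u) → value (T u u) ≡ value u →
                               value u ≤ ⋁ S → value u ≤ ⋁ R
        idempotent-atom-case {u} (u≢⊥ , u≤a) u-atom idem u≤⋁S =
          ≤-from-¬¬ (¬¬-excluded-middle {A = Σ Carrier λ x → S x × A x (value u)}) λ
          { (yes (x , sx , _ , u≤x)) →
              ≤-trans (idempotent≤extend u u≢⊥ idem u≤a u≤x) (⋁-ub R (x , sx , refl))
          ; (no ∄x) →
              contradiction (trans (sym idem) (atomCondition S ⋁S≢⊤ (value u) u-atom u≤⋁S ∄x)) u≢⊥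
          }

        atom-case : ∀ {u v} → κ L a u → κ L (⋁ S) v → IsAtom (value u) →
                    value (T u v) ≡ ⊥L ⊎ (u ≡ v × value (T u u) ≡ value u) → value (T u v) ≤ ⋁ R
        atom-case _ _ _ (inj₁ Tuv≡⊥) = subst (_≤ ⋁ R) (sym Tuv≡⊥) ⊥L-least
        atom-case ku (_ , u≤⋁S) u-atom (inj₂ (refl , idem)) =
          subst (_≤ ⋁ R) (sym idem) (idempotent-atom-case ku u-atom idem u≤⋁S)

        bound : ∀ {u v} → κ L a u → κ L (⋁ S) v → value (T u v) ≤ ⋁ R
        bound {u} {v} ku kv = ≤-from-¬¬ (κ-atom-or-⊤ (⋁ S) v kv) λ
          { (inj₂ ⋁S≡⊤) → contradiction ⋁S≡⊤ ⋁S≢⊤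
          ; (inj₁ v-atom) → ≤-from-¬¬ (κ-atom-or-⊤ a u ku) λ
            { (inj₂ a≡⊤) → begin
                value (T u v) ≤⟨ Txy≤y u v ⟩
                value v       ≤⟨ proj₂ kv ⟩
                ⋁ S           ≤⟨ ⋁-mono (S⊆R a≡⊤) ⟩
                ⋁ R           ∎
            ; (inj₁ u-atom) → atom-case ku kv u-atom (atom-product u-atom v-atom)
            }
          }

    module Restriction {T⋄ : Carrier → Carrier → Carrier} (isTNorm : IsTNormL L T⋄)
                       (lsc : IsLeftSemicontinuous L T⋄) where
      open IsTNorm isTNorm
      open TNormProperties isTNorm ⊤L-greatest
      open ≤-Reasoning

      InC-closed : ∀ {x y} → InC x → InC y → InC (T⋄ x y)
      InC-closed {x} {y} (inj₁ x-atom) _ with proj₂ x-atom (T⋄ x y) (Txy≤x x y)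
      ... | inj₁ Txy≡⊥ = inj₂ (inj₁ Txy≡⊥)
      ... | inj₂ Txy≡x = inj₁ (subst IsAtom (sym Txy≡x) x-atom)
      InC-closed {x} {y} (inj₂ (inj₁ x≡⊥)) _ = inj₂ (inj₁ (≤⊥L⇒≡⊥L (subst (T⋄ x y ≤_) x≡⊥ (Txy≤x x y))))
      InC-closed {x} {y} (inj₂ (inj₂ x≡⊤)) y∈C =
        subst InC (sym (trans (cong (λ x′ → T⋄ x′ y) x≡⊤) (identityˡ y))) y∈C

      restrict : C → C → C
      restrict u v = Refinement._,_ (T⋄ (value u) (value v))
                                    (Irrelevant.zipWith InC-closed (proof u) (proof v))

      restrict-isTNorm : IsTNormC L restrict
      restrict-isTNorm = record
        { monoˡ     = λ z → monoˡ (value z)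
        ; monoʳ     = λ z → monoʳ (value z)
        ; comm      = λ u v → value-injective (comm (value u) (value v))
        ; assoc     = λ u v w → value-injective (assoc (value u) (value v) (value w))
        ; identityʳ = λ u → value-injective (identityʳ (value u))
        }

      ≤-from-κʳ : ∀ x y {w} → (∀ v → κ L y v → T⋄ x (value v) ≤ w) → T⋄ x y ≤ w
      ≤-from-κʳ x y {w} h = ≤-from-¬¬ ¬¬-excluded-middle λ
        { (yes y≡⊤) → ⊤-case y≡⊤
        ; (no y≢⊤)  → non-⊤-case y≢⊤
        }
        where
        -- ⊤C ∈ κ ⊤L needs ⊤L ≢ ⊥L, which any atom below T⋄ x y witnesses.
        ⊤-case : y ≡ ⊤L → T⋄ x y ≤ w
        ⊤-case y≡⊤ = ≤-from-atoms λ a a-atom a≤Txy → ≤-trans a≤Txy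
          (subst (λ y′ → T⋄ x y′ ≤ w) (sym y≡⊤) (h ⊤C (atom⇒⊤L≢⊥L a-atom , ≤-reflexive (sym y≡⊤))))

        non-⊤-case : y ≢ ⊤L → T⋄ x y ≤ w
        non-⊤-case y≢⊤ with atomistic y
        ... | S , S-atoms , y≡⋁S = begin
          T⋄ x y     ≡⟨ cong (T⋄ x) y≡⋁S ⟩
          T⋄ x (⋁ S) ≡⟨ lsc x S (λ ⋁S≡⊤ → y≢⊤ (trans y≡⋁S ⋁S≡⊤)) ⟩
          ⋁ _        ≤⟨ ⋁-least _ (λ { (a , sa , refl) → h (atomC a (S-atoms sa))
                          (proj₁ (S-atoms sa) , subst (a ≤_) (sym y≡⋁S) (⋁-ub S sa)) }) ⟩
          w          ∎

      ≤-from-κˡ : ∀ x y {w} → (∀ u → κ L x u → T⋄ (value u) y ≤ w) → T⋄ x y ≤ w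
      ≤-from-κˡ x y {w} h = subst (_≤ w) (comm y x)
        (≤-from-κʳ y x λ u ku → subst (_≤ w) (comm (value u) y) (h u ku))

      extend-restrict : ∀ x y → T⋄ x y ≡ extend L restrict x y
      extend-restrict x y = ≤-antisym
        (≤-from-κˡ x y λ u ku → ≤-from-κʳ (value u) y λ v kv → extend-ub restrict {x} {y} {u} {v} ku kv)
        (extend-least restrict λ {u} {v} ku kv →
          ≤-trans (monoˡ (value v) (proj₂ ku)) (monoʳ x (proj₂ kv)))

      restrict-atomCondition : AtomCondition L restrict
      restrict-atomCondition S ⋁S≢⊤ u u-atom u≤⋁S ∄x = ≤⊥L⇒≡⊥L (begin
        T⋄ u u     ≤⟨ monoʳ u u≤⋁S ⟩
        T⋄ u (⋁ S) ≡⟨ lsc u S ⋁S≢⊤ ⟩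
        ⋁ _        ≤⟨ ⋁-least _ (λ { (x , sx , refl) → Tux≤⊥ sx }) ⟩
        ⊥L         ∎)
        where
        Tux≤⊥ : ∀ {x} → S x → T⋄ u x ≤ ⊥L
        Tux≤⊥ {x} sx with proj₂ u-atom (T⋄ u x) (Txy≤x u x)
        ... | inj₁ Tux≡⊥ = ≤-reflexive Tux≡⊥
        ... | inj₂ Tux≡u = contradiction (x , sx , u-atom , subst (_≤ x) Tux≡u (Txy≤y u x)) ∄x

theorem4p3 : ∀ {ℓ : Level} (L : CompleteLattice ℓ) → CompleteLattice.IsAtomistic L →
    (T⋄ : CompleteLattice.Carrier L → CompleteLattice.Carrier L → CompleteLattice.Carrier L) →
    IsLeftSemicontinuousTNorm L T⋄ ⇔
      Σ (CompleteLattice.C L → CompleteLattice.C L → CompleteLattice.C L) (λ T →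
        IsTNormC L T × (∀ x y → T⋄ x y ≡ extend L T x y) × AtomCondition L T)
theorem4p3 L atomistic T⋄ = mk⇔
  (λ (isTNorm , lsc) → let open Restriction L atomistic isTNorm lsc in
    restrict , restrict-isTNorm , extend-restrict , restrict-atomCondition)
  (λ (T , isTNorm , T⋄≗T̄ , atomCondition) → let open Extension L atomistic isTNorm in
    isTNorm-resp T⋄≗T̄ extend-isTNorm ,
    isLeftSemicontinuous-resp L T⋄≗T̄ (extend-isLeftSemicontinuous atomCondition))
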